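{- Let $n$ be a positive integer such that $2^n-1\geq 7$ is a (Mersenne) prime. Then for every $a\in\mathbb{F}_2$ there exists a primitive element $\alpha\in\mathbb{F}_{2^n}$ such that $\alpha+\alpha^{ -1}$ is also primitive and $\mathrm{Tr}_{\mathbb{F}_{2^n}|\mathbb{F}_2}(\alpha)=a$.
   Context: A primitive element of $\mathbb{F}_{2^n}$ is a generator of $\mathbb{F}_{2^n}^*$; $\mathrm{Tr}_{\mathbb{F}_{2^n}|\mathbb{F}_2}(\alpha)=\sum_{i=0}^{n-1}\alpha^{2^i}$. -}

module Defs where

open import Level using (0ℓ)
open import Data.Nat using (ℕ; zero; suc; _^_)
open import Data.Fin using (Fin)
open import Data.Bool using (Bool; true; false)
open import Data.Product using (Σ; ∃; _×_)
open import Relation.Binary.PropositionalEquality using (_≡_; _≢_)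
open import Algebra.Structures using (IsCommutativeRing)
open import Function.Bundles using (_↔_)

-- Since F_{2^n} is unique up to isomorphism,
-- quantifying over all such fields with q = 2^n is the same as speaking
-- about "the" field F_{2^n}.
record FiniteField (q : ℕ) : Set₁ where
  field
    Carrier : Set
    _+_ _*_ : Carrier → Carrier → Carrier
    -_      : Carrier → Carrier
    0# 1#   : Carrier
    isCommutativeRing : IsCommutativeRing _≡_ _+_ _*_ -_ 0# 1#
    0≢1     : 0# ≢ 1#
    inv     : (x : Carrier) → x ≢ 0# → Carrier
    inv-r   : (x : Carrier) (x≢0 : x ≢ 0#) → x * inv x x≢0 ≡ 1#
    card    : Carrier ↔ Fin q

  infixl 6 _+_
  infixl 7 _*_

  pow : Carrier → ℕ → Carrier
  pow x zero    = 1#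
  pow x (suc k) = x * pow x k

  Primitive : Carrier → Set
  Primitive α = (α ≢ 0#) × ((β : Carrier) → β ≢ 0# → ∃ λ k → pow α k ≡ β)

  traceSum : ℕ → Carrier → Carrier
  traceSum zero    x = 0#
  traceSum (suc m) x = traceSum m x + pow x (2 ^ m)

  embedF2 : Bool → Carrier
  embedF2 false = 0#
  embedF2 true  = 1#

-- Since the multiplicative group has prime order p, every element other
-- than 0 and 1 is primitive; so the task is to find α ∉ {0, 1} with
-- α + α⁻¹ ∉ {0, 1} and Tr(α) = a.
--   * Counting: x ↦ x + 1 permutes F, so the sum of all elements gives
--     q·1 = 0, whence 1 + 1 = 0 when q = 2^n.  Multiplication by x ≠ 0
--     permutes the nonzero elements, which gives Fermat's x^p = 1.
--   * Orders: y^d = 1 with d coprime to p forces y = 1 (Bézout); hence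
--     the powers y^0, …, y^(p-1) of y ∉ {0,1} are distinct and exhaust F*.
--   * α + α⁻¹ ∈ {0,1} would give α² = 1 or α³ = 1, so α = 1 as p > 3.
--   * Trace: Frobenius makes Tr additive with values in {0,1}; n is odd
--     (3 divides 4^k - 1), so Tr(1) = 1 and Tr(x + 1) = Tr(x) + 1.  Of
--     x and x + 1 (both ∉ {0,1}) one therefore has trace a.
module Submission where

open import Defs
open import Data.Nat as ℕ using (ℕ; zero; suc; _^_; _∸_; _≤_; _<_; s≤s; z≤n)
import Data.Nat.Properties as ℕP
open import Data.Nat.Solver using (module +-*-Solver)
open import Data.Nat.Divisibility using (divides)
open import Data.Nat.Coprimality using (Coprime; coprime-Bézout; prime⇒coprime)
open import Data.Nat.GCD using (module Bézout)
open import Data.Nat.Primality using (Prime; prime⇒irreducible)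
open import Data.Fin as Fin using (Fin; zero; suc; punchIn; punchOut; toℕ)
import Data.Fin.Properties as FinP
open import Data.Fin.Permutation using (Permutation; permutation)
open import Data.Product using (Σ; ∃; _×_; _,_; proj₁)
open import Data.Bool using (Bool; true; false)
open import Data.Sum using (_⊎_; inj₁; inj₂)
open import Data.Empty using (⊥-elim)
open import Relation.Nullary using (¬_; Dec; yes; no)
open import Relation.Binary using (tri<; tri≈; tri>)
open import Relation.Binary.PropositionalEquality
open import Function.Bundles using (_↔_; Inverse)
open import Function.Definitions using (Injective)
open import Algebra.Bundles using (CommutativeRing)
import Algebra.Properties.CommutativeMonoid.Sum as MonoidSum
import Algebra.Properties.Monoid.Mult as MonoidMult
import Algebra.Properties.Semiring.Mult as SemiringMult

even-or-odd : ∀ n → (∃ λ k → n ≡ k ℕ.+ k) ⊎ (∃ λ k → n ≡ suc (k ℕ.+ k))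
even-or-odd zero = inj₁ (0 , refl)
even-or-odd (suc n) with even-or-odd n
... | inj₁ (k , n≡2k)   = inj₂ (k , cong suc n≡2k)
... | inj₂ (k , n≡2k+1) = inj₁ (suc k , cong suc (trans n≡2k+1 (sym (ℕP.+-suc k k))))

four^k≡1[3] : ∀ k → ∃ λ c → 2 ^ (k ℕ.+ k) ≡ suc (3 ℕ.* c)
four^k≡1[3] zero = 0 , refl
four^k≡1[3] (suc k) with four^k≡1[3] k
... | c , eq = suc (4 ℕ.* c) , (begin
    2 ^ (suc k ℕ.+ suc k)            ≡⟨ cong (λ m → 2 ^ suc m) (ℕP.+-suc k k) ⟩
    2 ℕ.* (2 ℕ.* 2 ^ (k ℕ.+ k))      ≡⟨ cong (λ m → 2 ℕ.* (2 ℕ.* m)) eq ⟩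
    2 ℕ.* (2 ℕ.* suc (3 ℕ.* c))      ≡⟨ solve 1 (λ c → con 2 :* (con 2 :* (con 1 :+ con 3 :* c))
                                          := con 1 :+ con 3 :* (con 1 :+ con 4 :* c)) refl c ⟩
    suc (3 ℕ.* suc (4 ℕ.* c))        ∎)
  where
    open ≡-Reasoning
    open +-*-Solver

-- A Mersenne prime 2^n - 1 ≥ 7 has odd exponent: for n = 2k the number
-- 3 would be a proper divisor of 4^k - 1.
mersenne-exponent-odd : ∀ n → Prime (2 ^ n ∸ 1) → 7 ≤ 2 ^ n ∸ 1 → ∃ λ k → n ≡ suc (k ℕ.+ k)
mersenne-exponent-odd n p-prime 7≤p with even-or-odd n
... | inj₂ n-odd = n-odd
... | inj₁ (k , refl) with four^k≡1[3] k
...   | c , eq with prime⇒irreducible p-prime (divides c (trans (cong (_∸ 1) eq) (ℕP.*-comm 3 c)))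
...     | inj₁ ()
...     | inj₂ 3≡p = ⊥-elim (7≰3 (subst (7 ≤_) (sym 3≡p) 7≤p))
  where
    7≰3 : ¬ 7 ≤ 3
    7≰3 (s≤s (s≤s (s≤s ())))

injective⇒surjective : ∀ {m} (f : Fin m → Fin m) → Injective _≡_ _≡_ f → ∀ b → ∃ λ i → f i ≡ b
injective⇒surjective {m} f f-inj b = collision (FinP.pigeonhole (ℕP.n<1+n m) g)
  where
    g : Fin (suc m) → Fin m
    g zero    = b
    g (suc i) = f i
    collision : (∃ λ i → ∃ λ j → i Fin.< j × g i ≡ g j) → ∃ λ i → f i ≡ b
    collision (zero  , suc j , _   , b≡fj)  = j , sym b≡fj
    collision (suc i , suc j , i<j , fi≡fj) = ⊥-elim (FinP.<-irrefl (cong suc (f-inj fi≡fj)) i<j)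

module FieldTheory {q : ℕ} (F : FiniteField q) (p : ℕ) (q≡1+p : q ≡ suc p) where
  open FiniteField F public

  ring : CommutativeRing _ _
  ring = record { isCommutativeRing = isCommutativeRing }

  open CommutativeRing ring public
    using ( +-assoc; +-comm; +-identityˡ; +-identityʳ; -‿inverseˡ; -‿inverseʳ
          ; *-assoc; *-comm; *-identityˡ; *-identityʳ; zeroˡ; zeroʳ; distribˡ)
  open import Algebra.Solver.Ring.NaturalCoefficients.Default
    (CommutativeRing.commutativeSemiring ring)
  module Additive       = MonoidSum (CommutativeRing.+-commutativeMonoid ring)
  module Multiplicative = MonoidSum (CommutativeRing.*-commutativeMonoid ring)
  module Multiples      = SemiringMult (CommutativeRing.semiring ring)
  module Powers         = MonoidMult (CommutativeRing.*-monoid ring)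

  enum : Carrier ↔ Fin (suc p)
  enum = subst (λ k → Carrier ↔ Fin k) q≡1+p card

  index : Carrier → Fin (suc p)
  index = Inverse.to enum

  element : Fin (suc p) → Carrier
  element = Inverse.from enum

  element-index : ∀ x → element (index x) ≡ x
  element-index x = Inverse.inverseʳ enum refl

  index-element : ∀ i → index (element i) ≡ i
  index-element i = Inverse.inverseˡ enum refl

  index-injective : ∀ {x y} → index x ≡ index y → x ≡ y
  index-injective {x} {y} eq = trans (sym (element-index x)) (trans (cong element eq) (element-index y))

  _≟_ : (x y : Carrier) → Dec (x ≡ y)
  x ≟ y with index x FinP.≟ index y
  ... | yes eq = yes (index-injective eq)
  ... | no neq = no (λ eq → neq (cong index eq))

  1≢0 : 1# ≢ 0#
  1≢0 eq = 0≢1 (sym eq)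

  inv-l : ∀ x (x≢0 : x ≢ 0#) → inv x x≢0 * x ≡ 1#
  inv-l x x≢0 = trans (*-comm _ _) (inv-r x x≢0)

  cancel : ∀ {x a b} → x ≢ 0# → x * a ≡ x * b → a ≡ b
  cancel {x} {a} {b} x≢0 eq = begin
      a                       ≡⟨ sym (*-identityˡ a) ⟩
      1# * a                  ≡⟨ cong (_* a) (sym (inv-l x x≢0)) ⟩
      inv x x≢0 * x * a       ≡⟨ *-assoc _ _ _ ⟩
      inv x x≢0 * (x * a)     ≡⟨ cong (inv x x≢0 *_) eq ⟩
      inv x x≢0 * (x * b)     ≡⟨ sym (*-assoc _ _ _) ⟩
      inv x x≢0 * x * b       ≡⟨ cong (_* b) (inv-l x x≢0) ⟩
      1# * b                  ≡⟨ *-identityˡ b ⟩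
      b                       ∎
    where open ≡-Reasoning

  *-nonzero : ∀ {x y} → x ≢ 0# → y ≢ 0# → x * y ≢ 0#
  *-nonzero {x} x≢0 y≢0 eq = y≢0 (cancel x≢0 (trans eq (sym (zeroʳ x))))

  inv-nonzero : ∀ x (x≢0 : x ≢ 0#) → inv x x≢0 ≢ 0#
  inv-nonzero x x≢0 eq = 1≢0 (trans (sym (inv-r x x≢0)) (trans (cong (x *_) eq) (zeroʳ x)))

  pow-nonzero : ∀ {x} k → x ≢ 0# → pow x k ≢ 0#
  pow-nonzero zero    x≢0 = 1≢0
  pow-nonzero (suc k) x≢0 = *-nonzero x≢0 (pow-nonzero k x≢0)

  pow-+ : ∀ x a b → pow x (a ℕ.+ b) ≡ pow x a * pow x b
  pow-+ x zero    b = sym (*-identityˡ _)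
  pow-+ x (suc a) b = trans (cong (x *_) (pow-+ x a b)) (sym (*-assoc _ _ _))

  pow-* : ∀ x a b → pow x (a ℕ.* b) ≡ pow (pow x b) a
  pow-* x zero    b = refl
  pow-* x (suc a) b = trans (pow-+ x b (a ℕ.* b)) (cong (pow x b *_) (pow-* x a b))

  pow-1# : ∀ k → pow 1# k ≡ 1#
  pow-1# zero    = refl
  pow-1# (suc k) = trans (*-identityˡ _) (pow-1# k)

  pow-as-product : ∀ k x → k Powers.× x ≡ pow x k
  pow-as-product zero    x = refl
  pow-as-product (suc k) x = cong (x *_) (pow-as-product k x)

  fromℕ : ℕ → Carrier
  fromℕ k = k Multiples.× 1#

  fromℕ-2^ : ∀ k → fromℕ (2 ^ k) ≡ pow (1# + 1#) k
  fromℕ-2^ zero    = +-identityʳ 1#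
  fromℕ-2^ (suc k) = trans (Multiples.×1-homo-* 2 (2 ^ k))
                       (cong₂ _*_ (cong (1# +_) (+-identityʳ 1#)) (fromℕ-2^ k))

  shift : Permutation (suc p) (suc p)
  shift = permutation (λ i → index (element i + 1#)) (λ i → index (element i + - 1#))
    (λ i → trans (cong (λ x → index (x + 1#)) (element-index _))
             (trans (cong index (cancel-1 (element i))) (index-element i)))
    (λ i → trans (cong (λ x → index (x + - 1#)) (element-index _))
             (trans (cong index (cancel+1 (element i))) (index-element i)))
    where
      cancel-1 : ∀ x → x + - 1# + 1# ≡ x
      cancel-1 x = trans (+-assoc _ _ _) (trans (cong (x +_) (-‿inverseˡ 1#)) (+-identityʳ x))
      cancel+1 : ∀ x → x + 1# + - 1# ≡ x
      cancel+1 x = trans (+-assoc _ _ _) (trans (cong (x +_) (-‿inverseʳ 1#)) (+-identityʳ x))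

  -- The size of F vanishes in F: the sum S of all elements satisfies
  -- S = S + q·1, as translation by 1 permutes the elements.
  size-vanishes : fromℕ (suc p) ≡ 0#
  size-vanishes = add-cancel (sym (begin
      S                                          ≡⟨ Additive.sum-permute element shift ⟩
      ∑ (λ i → element (index (element i + 1#))) ≡⟨ Additive.sum-cong-≗ (λ i → element-index (element i + 1#)) ⟩
      ∑ (λ i → element i + 1#)                   ≡⟨ Additive.∑-distrib-+ element (λ _ → 1#) ⟩
      S + ∑ (λ _ → 1#)                           ≡⟨ cong (S +_) (Additive.sum-replicate (suc p)) ⟩
      S + fromℕ (suc p)                          ∎))
    where
      open ≡-Reasoning
      ∑ : (Fin (suc p) → Carrier) → Carrier
      ∑ = Additive.sum
      S : Carrier
      S = ∑ element
      add-cancel : ∀ {a b} → a + b ≡ a → b ≡ 0#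
      add-cancel {a} {b} eq = begin
        b               ≡⟨ sym (+-identityˡ b) ⟩
        0# + b          ≡⟨ cong (_+ b) (sym (-‿inverseˡ a)) ⟩
        - a + a + b     ≡⟨ +-assoc _ _ _ ⟩
        - a + (a + b)   ≡⟨ cong (- a +_) eq ⟩
        - a + a         ≡⟨ -‿inverseˡ a ⟩
        0#              ∎

  char-two : ∀ n → q ≡ 2 ^ n → 1# + 1# ≡ 0#
  char-two n q≡2^n with (1# + 1#) ≟ 0#
  ... | yes two≡0 = two≡0
  ... | no  two≢0 = ⊥-elim (pow-nonzero n two≢0 (begin
      pow (1# + 1#) n  ≡⟨ sym (fromℕ-2^ n) ⟩
      fromℕ (2 ^ n)    ≡⟨ cong fromℕ (trans (sym q≡2^n) q≡1+p) ⟩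
      fromℕ (suc p)    ≡⟨ size-vanishes ⟩
      0#               ∎))
    where open ≡-Reasoning

  unit : Fin p → Carrier
  unit j = element (punchIn (index 0#) j)

  unit-nonzero : ∀ j → unit j ≢ 0#
  unit-nonzero j eq = FinP.punchInᵢ≢i (index 0#) j (trans (sym (index-element _)) (cong index eq))

  unitIndex : (x : Carrier) → x ≢ 0# → Fin p
  unitIndex x x≢0 = punchOut {i = index 0#} {j = index x} (λ eq → x≢0 (index-injective (sym eq)))

  unit-unitIndex : ∀ x (x≢0 : x ≢ 0#) → unit (unitIndex x x≢0) ≡ x
  unit-unitIndex x x≢0 = trans (cong element (FinP.punchIn-punchOut _)) (element-index x)

  unitIndex-unit : ∀ x (x≢0 : x ≢ 0#) j → x ≡ unit j → unitIndex x x≢0 ≡ j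
  unitIndex-unit x x≢0 j eq =
    trans (FinP.punchOut-cong (index 0#) (trans (cong index eq) (index-element _)))
          (FinP.punchOut-punchIn (index 0#))

  unitIndex-injective : ∀ {x y} (x≢0 : x ≢ 0#) (y≢0 : y ≢ 0#) → unitIndex x x≢0 ≡ unitIndex y y≢0 → x ≡ y
  unitIndex-injective {x} {y} x≢0 y≢0 eq =
    trans (sym (unit-unitIndex x x≢0)) (trans (cong unit eq) (unit-unitIndex y y≢0))

  scale : ∀ y → y ≢ 0# → Fin p → Fin p
  scale y y≢0 j = unitIndex (y * unit j) (*-nonzero y≢0 (unit-nonzero j))

  unit-scale : ∀ y (y≢0 : y ≢ 0#) j → unit (scale y y≢0 j) ≡ y * unit j
  unit-scale y y≢0 j = unit-unitIndex (y * unit j) (*-nonzero y≢0 (unit-nonzero j))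

  scale-undo : ∀ {y z} (y≢0 : y ≢ 0#) (z≢0 : z ≢ 0#) → y * z ≡ 1# → ∀ j → scale y y≢0 (scale z z≢0 j) ≡ j
  scale-undo {y} {z} y≢0 z≢0 yz≡1 j = unitIndex-unit _ (*-nonzero y≢0 (unit-nonzero _)) j (begin
      y * unit (scale z z≢0 j)   ≡⟨ cong (y *_) (unit-scale z z≢0 j) ⟩
      y * (z * unit j)           ≡⟨ sym (*-assoc y z (unit j)) ⟩
      y * z * unit j             ≡⟨ cong (_* unit j) yz≡1 ⟩
      1# * unit j                ≡⟨ *-identityˡ (unit j) ⟩
      unit j                     ∎)
    where open ≡-Reasoning

  scaling : ∀ x → x ≢ 0# → Permutation p p
  scaling x x≢0 = permutation (scale x x≢0) (scale (inv x x≢0) x⁻¹≢0)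
      (scale-undo x≢0 x⁻¹≢0 (inv-r x x≢0)) (scale-undo x⁻¹≢0 x≢0 (inv-l x x≢0))
    where
      x⁻¹≢0 : inv x x≢0 ≢ 0#
      x⁻¹≢0 = inv-nonzero x x≢0

  product-nonzero : ∀ {m} (f : Fin m → Carrier) → (∀ i → f i ≢ 0#) → Multiplicative.sum f ≢ 0#
  product-nonzero {zero}  f f≢0 = 1≢0
  product-nonzero {suc m} f f≢0 = *-nonzero (f≢0 zero) (product-nonzero (λ i → f (suc i)) (λ i → f≢0 (suc i)))

  -- Fermat: the product P of all nonzero elements satisfies P = x^p P.
  fermat : ∀ x → x ≢ 0# → pow x p ≡ 1#
  fermat x x≢0 = cancel (product-nonzero unit unit-nonzero)
                   (trans (*-comm P (pow x p)) (trans (sym P≡x^pP) (sym (*-identityʳ P))))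
    where
      open ≡-Reasoning
      Π : (Fin p → Carrier) → Carrier
      Π = Multiplicative.sum
      P : Carrier
      P = Π unit
      P≡x^pP : P ≡ pow x p * P
      P≡x^pP = begin
        P                                ≡⟨ Multiplicative.sum-permute unit (scaling x x≢0) ⟩
        Π (λ j → unit (scale x x≢0 j))   ≡⟨ Multiplicative.sum-cong-≗ (unit-scale x x≢0) ⟩
        Π (λ j → x * unit j)             ≡⟨ Multiplicative.∑-distrib-+ (λ _ → x) unit ⟩
        Π (λ _ → x) * P                  ≡⟨ cong (_* P) (Multiplicative.sum-replicate p) ⟩
        p Powers.× x * P                 ≡⟨ cong (_* P) (pow-as-product p x) ⟩
        pow x p * P                      ∎

  pow-size : ∀ x → pow x q ≡ x
  pow-size x with x ≟ 0#
  ... | yes refl = trans (cong (pow 0#) q≡1+p) (zeroˡ _)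
  ... | no  x≢0  = trans (cong (pow x) q≡1+p) (trans (cong (x *_) (fermat x x≢0)) (*-identityʳ x))

  pow-multiple : ∀ {y e} k → pow y e ≡ 1# → pow y (k ℕ.* e) ≡ 1#
  pow-multiple {y} {e} k y^e≡1 = trans (pow-* y k e) (trans (cong (λ z → pow z k) y^e≡1) (pow-1# k))

  pow-1+multiple : ∀ {y e} k → pow y e ≡ 1# → pow y (1 ℕ.+ k ℕ.* e) ≡ y
  pow-1+multiple {y} k y^e≡1 = trans (cong (y *_) (pow-multiple k y^e≡1)) (*-identityʳ y)

  -- If y^d = 1 for some d coprime to p, then y = 1: by Bézout some
  -- 1 + (multiple of d) equals a multiple of p, or vice versa.
  order-coprime : ∀ {y d} → y ≢ 0# → Coprime p d → pow y d ≡ 1# → y ≡ 1#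
  order-coprime {y} {d} y≢0 coprime y^d≡1 with coprime-Bézout coprime
  ... | Bézout.+- a b eq = trans (sym (pow-1+multiple b y^d≡1)) (trans (cong (pow y) eq) (pow-multiple a (fermat y y≢0)))
  ... | Bézout.-+ a b eq = trans (sym (pow-1+multiple a (fermat y y≢0))) (trans (cong (pow y) eq) (pow-multiple b y^d≡1))

  -- For y ∉ {0,1} the powers y^a, a < p, are pairwise distinct (p prime):
  -- y^a = y^b with a < b would give y^(b-a) = 1 with 0 < b - a < p.
  powers-distinct : Prime p → ∀ {y} → y ≢ 0# → y ≢ 1# → ∀ {a b} → a < b → b < p → pow y a ≢ pow y b
  powers-distinct p-prime {y} y≢0 y≢1 {a} {b} a<b b<p y^a≡y^b =
      y≢1 (order-coprime y≢0 (prime⇒coprime p-prime {{ℕ.>-nonZero 0<d}} d<p) y^d≡1)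
    where
      open ≡-Reasoning
      d : ℕ
      d = b ∸ a
      0<d : 0 < d
      0<d = ℕP.m<n⇒0<n∸m a<b
      d<p : d < p
      d<p = ℕP.≤-<-trans (ℕP.m∸n≤m b a) b<p
      y^d≡1 : pow y d ≡ 1#
      y^d≡1 = cancel (pow-nonzero a y≢0) (begin
        pow y a * pow y d    ≡⟨ sym (pow-+ y a d) ⟩
        pow y (a ℕ.+ d)      ≡⟨ cong (pow y) (ℕP.m+[n∸m]≡n (ℕP.<⇒≤ a<b)) ⟩
        pow y b              ≡⟨ sym y^a≡y^b ⟩
        pow y a              ≡⟨ sym (*-identityʳ _) ⟩
        pow y a * 1#         ∎)

  -- When the multiplicative group has prime order p, every element other
  -- than 0 and 1 is primitive: its p distinct powers exhaust the p units.
  prime-order-primitive : Prime p → ∀ {y} → y ≢ 0# → y ≢ 1# → Primitive y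
  prime-order-primitive p-prime {y} y≢0 y≢1 = y≢0 , reach
    where
      power : Fin p → Fin p
      power k = unitIndex (pow y (toℕ k)) (pow-nonzero (toℕ k) y≢0)
      power-values : ∀ {i j} → power i ≡ power j → pow y (toℕ i) ≡ pow y (toℕ j)
      power-values {i} {j} = unitIndex-injective (pow-nonzero (toℕ i) y≢0) (pow-nonzero (toℕ j) y≢0)
      power-injective : Injective _≡_ _≡_ power
      power-injective {i} {j} eq with ℕP.<-cmp (toℕ i) (toℕ j)
      ... | tri< i<j _ _ = ⊥-elim (powers-distinct p-prime y≢0 y≢1 i<j (FinP.toℕ<n j) (power-values {i} {j} eq))
      ... | tri≈ _ i≡j _ = FinP.toℕ-injective i≡j
      ... | tri> _ _ j<i = ⊥-elim (powers-distinct p-prime y≢0 y≢1 j<i (FinP.toℕ<n i) (sym (power-values {i} {j} eq)))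
      reach : ∀ β → β ≢ 0# → ∃ λ k → pow y k ≡ β
      reach β β≢0 with injective⇒surjective power power-injective (unitIndex β β≢0)
      ... | k , eq = toℕ k , unitIndex-injective (pow-nonzero (toℕ k) y≢0) β≢0 eq

  unit-injective : ∀ {i j} → unit i ≡ unit j → i ≡ j
  unit-injective {i} {j} eq =
    FinP.punchIn-injective (index 0#) i j (trans (sym (index-element _)) (trans (cong index eq) (index-element _)))

  non-binary : 2 ≤ p → Σ Carrier λ x → x ≢ 0# × x ≢ 1#
  non-binary 2≤p = choose (unit i₀ ≟ 1#)
    where
      i₀ i₁ : Fin p
      i₀ = Fin.fromℕ< {0} (ℕP.≤-trans (s≤s z≤n) 2≤p)
      i₁ = Fin.fromℕ< {1} 2≤p
      i₀≢i₁ : i₀ ≢ i₁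
      i₀≢i₁ eq with trans (sym (FinP.toℕ-fromℕ< _)) (trans (cong toℕ eq) (FinP.toℕ-fromℕ< _))
      ... | ()
      choose : Dec (unit i₀ ≡ 1#) → Σ Carrier λ x → x ≢ 0# × x ≢ 1#
      choose (no  u₀≢1) = unit i₀ , unit-nonzero i₀ , u₀≢1
      choose (yes u₀≡1) = unit i₁ , unit-nonzero i₁ , λ u₁≡1 → i₀≢i₁ (unit-injective (trans u₀≡1 (sym u₁≡1)))

  idempotent-binary : ∀ {t} → pow t 2 ≡ t → t ≡ 0# ⊎ t ≡ 1#
  idempotent-binary {t} t²≡t with t ≟ 0#
  ... | yes t≡0 = inj₁ t≡0
  ... | no  t≢0 = inj₂ (cancel t≢0 (trans (cong (t *_) (sym (*-identityʳ t))) (trans t²≡t (sym (*-identityʳ t)))))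

  module CharacteristicTwo (two≡0 : 1# + 1# ≡ 0#) where
    open ≡-Reasoning

    x+x≡0 : ∀ x → x + x ≡ 0#
    x+x≡0 x = begin
      x + x            ≡⟨ solve 1 (λ x → x :+ x := (con 1 :+ con 1) :* x) refl x ⟩
      (1# + 1#) * x    ≡⟨ cong (_* x) two≡0 ⟩
      0# * x           ≡⟨ zeroˡ x ⟩
      0#               ∎

    shift-back : ∀ {x c} → x + 1# ≡ c → x ≡ c + 1#
    shift-back {x} {c} eq = begin
      x                ≡⟨ sym (+-identityʳ x) ⟩
      x + 0#           ≡⟨ cong (x +_) (sym two≡0) ⟩
      x + (1# + 1#)    ≡⟨ sym (+-assoc x 1# 1#) ⟩
      x + 1# + 1#      ≡⟨ cong (_+ 1#) eq ⟩
      c + 1#           ∎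

    sum≡0⇒≡ : ∀ {a b} → a + b ≡ 0# → a ≡ b
    sum≡0⇒≡ {a} {b} eq = begin
      a                ≡⟨ sym (+-identityʳ a) ⟩
      a + 0#           ≡⟨ cong (a +_) (sym (x+x≡0 b)) ⟩
      a + (b + b)      ≡⟨ sym (+-assoc a b b) ⟩
      a + b + b        ≡⟨ cong (_+ b) eq ⟩
      0# + b           ≡⟨ +-identityˡ b ⟩
      b                ∎

    square-additive : ∀ x y → pow (x + y) 2 ≡ pow x 2 + pow y 2
    square-additive x y = begin
      pow (x + y) 2                              ≡⟨ solve 2 (λ x y → (x :+ y) :* ((x :+ y) :* con 1)
                                                      := x :* (x :* con 1) :+ y :* (y :* con 1) :+ (con 1 :+ con 1) :* (x :* y)) refl x y ⟩
      pow x 2 + pow y 2 + (1# + 1#) * (x * y)    ≡⟨ cong (λ t → pow x 2 + pow y 2 + t * (x * y)) two≡0 ⟩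
      pow x 2 + pow y 2 + 0# * (x * y)           ≡⟨ cong (pow x 2 + pow y 2 +_) (zeroˡ (x * y)) ⟩
      pow x 2 + pow y 2 + 0#                     ≡⟨ +-identityʳ _ ⟩
      pow x 2 + pow y 2                          ∎

    frobenius : ∀ m x y → pow (x + y) (2 ^ m) ≡ pow x (2 ^ m) + pow y (2 ^ m)
    frobenius zero    x y = solve 2 (λ x y → (x :+ y) :* con 1 := x :* con 1 :+ y :* con 1) refl x y
    frobenius (suc m) x y = begin
      pow (x + y) (2 ^ suc m)                    ≡⟨ pow-* (x + y) 2 (2 ^ m) ⟩
      pow (pow (x + y) (2 ^ m)) 2                ≡⟨ cong (λ t → pow t 2) (frobenius m x y) ⟩
      pow (pow x (2 ^ m) + pow y (2 ^ m)) 2      ≡⟨ square-additive _ _ ⟩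
      pow (pow x (2 ^ m)) 2 + pow (pow y (2 ^ m)) 2
                                                 ≡⟨ sym (cong₂ _+_ (pow-* x 2 (2 ^ m)) (pow-* y 2 (2 ^ m))) ⟩
      pow x (2 ^ suc m) + pow y (2 ^ suc m)      ∎

    trace-additive : ∀ m x y → traceSum m (x + y) ≡ traceSum m x + traceSum m y
    trace-additive zero    x y = sym (+-identityʳ 0#)
    trace-additive (suc m) x y = begin
      traceSum m (x + y) + pow (x + y) (2 ^ m)
        ≡⟨ cong₂ _+_ (trace-additive m x y) (frobenius m x y) ⟩
      (traceSum m x + traceSum m y) + (pow x (2 ^ m) + pow y (2 ^ m))
        ≡⟨ solve 4 (λ a b c d → (a :+ b) :+ (c :+ d) := (a :+ c) :+ (b :+ d)) refl _ _ _ _ ⟩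
      traceSum (suc m) x + traceSum (suc m) y
        ∎

    trace-one : ∀ m → traceSum m 1# ≡ fromℕ m
    trace-one zero    = refl
    trace-one (suc m) = trans (cong₂ _+_ (trace-one m) (pow-1# (2 ^ m))) (+-comm (fromℕ m) 1#)

    trace-one-odd : ∀ k → traceSum (suc (k ℕ.+ k)) 1# ≡ 1#
    trace-one-odd k = begin
      traceSum (suc (k ℕ.+ k)) 1#    ≡⟨ trace-one (suc (k ℕ.+ k)) ⟩
      1# + fromℕ (k ℕ.+ k)           ≡⟨ cong (1# +_) (Multiples.×-homo-+ 1# k k) ⟩
      1# + (fromℕ k + fromℕ k)       ≡⟨ cong (1# +_) (x+x≡0 (fromℕ k)) ⟩
      1# + 0#                        ≡⟨ +-identityʳ 1# ⟩
      1#                             ∎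

    trace-step : ∀ m x → traceSum (suc m) x ≡ x + pow (traceSum m x) 2
    trace-step zero    x = solve 1 (λ x → con 0 :+ x :* con 1 := x :+ con 0 :* (con 0 :* con 1)) refl x
    trace-step (suc m) x = begin
      traceSum (suc m) x + pow x (2 ^ suc m)                ≡⟨ cong₂ _+_ (trace-step m x) (pow-* x 2 (2 ^ m)) ⟩
      x + pow (traceSum m x) 2 + pow (pow x (2 ^ m)) 2      ≡⟨ +-assoc _ _ _ ⟩
      x + (pow (traceSum m x) 2 + pow (pow x (2 ^ m)) 2)    ≡⟨ cong (x +_) (sym (square-additive _ _)) ⟩
      x + pow (traceSum (suc m) x) 2                        ∎

    trace-idempotent : ∀ m x → pow x (2 ^ suc m) ≡ x → pow (traceSum (suc m) x) 2 ≡ traceSum (suc m) x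
    trace-idempotent m x x-fixed = begin
      pow (traceSum m x + pow x (2 ^ m)) 2                  ≡⟨ square-additive _ _ ⟩
      pow (traceSum m x) 2 + pow (pow x (2 ^ m)) 2          ≡⟨ cong (pow (traceSum m x) 2 +_) (sym (pow-* x 2 (2 ^ m))) ⟩
      pow (traceSum m x) 2 + pow x (2 ^ suc m)              ≡⟨ cong (pow (traceSum m x) 2 +_) x-fixed ⟩
      pow (traceSum m x) 2 + x                              ≡⟨ +-comm _ x ⟩
      x + pow (traceSum m x) 2                              ≡⟨ sym (trace-step m x) ⟩
      traceSum (suc m) x                                    ∎

    trace-binary : ∀ m → q ≡ 2 ^ suc m → ∀ x → traceSum (suc m) x ≡ 0# ⊎ traceSum (suc m) x ≡ 1#
    trace-binary m q≡2^m+1 x =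
      idempotent-binary (trace-idempotent m x (subst (λ k → pow x k ≡ x) q≡2^m+1 (pow-size x)))

    -- For odd n, of x and x + 1 (both ∉ {0,1} if x is) one has any
    -- prescribed trace, since Tr(x + 1) = Tr(x) + 1.
    prescribed-trace : ∀ k → q ≡ 2 ^ suc (k ℕ.+ k) → ∀ {x} → x ≢ 0# → x ≢ 1# → (a : Bool) →
      Σ Carrier λ α → α ≢ 0# × α ≢ 1# × traceSum (suc (k ℕ.+ k)) α ≡ embedF2 a
    prescribed-trace k q≡2^n {x} x≢0 x≢1 = choose (trace-binary (k ℕ.+ k) q≡2^n x)
      where
        n : ℕ
        n = suc (k ℕ.+ k)
        Tr[x+1] : traceSum n (x + 1#) ≡ traceSum n x + 1#
        Tr[x+1] = trans (trace-additive n x 1#) (cong (traceSum n x +_) (trace-one-odd k))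
        x+1≢0 : x + 1# ≢ 0#
        x+1≢0 eq = x≢1 (trans (shift-back eq) (+-identityˡ 1#))
        x+1≢1 : x + 1# ≢ 1#
        x+1≢1 eq = x≢0 (trans (shift-back eq) two≡0)
        choose : traceSum n x ≡ 0# ⊎ traceSum n x ≡ 1# → (a : Bool) →
          Σ Carrier λ α → α ≢ 0# × α ≢ 1# × traceSum n α ≡ embedF2 a
        choose (inj₁ Tr≡0) false = x , x≢0 , x≢1 , Tr≡0
        choose (inj₁ Tr≡0) true  = x + 1# , x+1≢0 , x+1≢1 , trans Tr[x+1] (trans (cong (_+ 1#) Tr≡0) (+-identityˡ 1#))
        choose (inj₂ Tr≡1) true  = x , x≢0 , x≢1 , Tr≡1
        choose (inj₂ Tr≡1) false = x + 1# , x+1≢0 , x+1≢1 , trans Tr[x+1] (trans (cong (_+ 1#) Tr≡1) two≡0)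

    -- For α ∉ {0,1}, also α + α⁻¹ ∉ {0,1}: otherwise α² = 1 or α³ = 1,
    -- forcing α = 1 as p is a prime above 3.
    inverse-sum-non-binary : Prime p → 3 < p → ∀ {α} (α≢0 : α ≢ 0#) → α ≢ 1# →
      α + inv α α≢0 ≢ 0# × α + inv α α≢0 ≢ 1#
    inverse-sum-non-binary p-prime 3<p {α} α≢0 α≢1 = sum≢0 , sum≢1
      where
        β : Carrier
        β = inv α α≢0
        sum≢0 : α + β ≢ 0#
        sum≢0 eq = α≢1 (order-coprime α≢0 (prime⇒coprime p-prime (ℕP.<-trans (s≤s (s≤s (s≤s z≤n))) 3<p)) (begin
          pow α 2      ≡⟨ cong (α *_) (*-identityʳ α) ⟩
          α * α        ≡⟨ cong (α *_) (sum≡0⇒≡ eq) ⟩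
          α * β        ≡⟨ inv-r α α≢0 ⟩
          1#           ∎))
        α²≡α+1 : α + β ≡ 1# → α * α ≡ α + 1#
        α²≡α+1 eq = shift-back (begin
          α * α + 1#       ≡⟨ cong (α * α +_) (sym (inv-r α α≢0)) ⟩
          α * α + α * β    ≡⟨ sym (distribˡ α α β) ⟩
          α * (α + β)      ≡⟨ cong (α *_) eq ⟩
          α * 1#           ≡⟨ *-identityʳ α ⟩
          α                ∎)
        sum≢1 : α + β ≢ 1#
        sum≢1 eq = α≢1 (order-coprime α≢0 (prime⇒coprime p-prime 3<p) (begin
          pow α 3          ≡⟨ solve 1 (λ a → a :* (a :* (a :* con 1)) := a :* (a :* a)) refl α ⟩
          α * (α * α)      ≡⟨ cong (α *_) (α²≡α+1 eq) ⟩
          α * (α + 1#)     ≡⟨ distribˡ α α 1# ⟩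
          α * α + α * 1#   ≡⟨ cong₂ _+_ (α²≡α+1 eq) (*-identityʳ α) ⟩
          α + 1# + α       ≡⟨ solve 1 (λ a → a :+ con 1 :+ a := con 1 :+ (a :+ a)) refl α ⟩
          1# + (α + α)     ≡⟨ cong (1# +_) (x+x≡0 α) ⟩
          1# + 0#          ≡⟨ +-identityʳ 1# ⟩
          1#               ∎))

lemma6p1 : (n : ℕ) → 1 ≤ n → Prime (2 ^ n ∸ 1) → 7 ≤ 2 ^ n ∸ 1 →
    (F : FiniteField (2 ^ n)) → let open FiniteField F in
    (a : Bool) →
    Σ Carrier λ α → Σ (Primitive α) λ pα →
      Primitive (α + inv α (proj₁ pα)) × (traceSum n α ≡ embedF2 a)
lemma6p1 n _ p-prime 7≤p F a =
  let open FieldTheory F (2 ^ n ∸ 1) size≡1+p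
      open CharacteristicTwo (char-two n refl)
      (k , n≡2k+1)           = mersenne-exponent-odd n p-prime 7≤p
      (x , x≢0 , x≢1)        = non-binary (ℕP.≤-trans 2≤7 7≤p)
      (α , α≢0 , α≢1 , Trα)  = prescribed-trace k (cong (2 ^_) n≡2k+1) x≢0 x≢1 a
      (s≢0 , s≢1)            = inverse-sum-non-binary p-prime (ℕP.<-≤-trans 3<7 7≤p) α≢0 α≢1
  in α , prime-order-primitive p-prime α≢0 α≢1 , prime-order-primitive p-prime s≢0 s≢1
       , subst (λ m → traceSum m α ≡ embedF2 a) (sym n≡2k+1) Trα
  where
    size≡1+p : 2 ^ n ≡ suc (2 ^ n ∸ 1)
    size≡1+p = sym (ℕP.m+[n∸m]≡n (ℕP.m^n>0 2 n))
    2≤7 : 2 ≤ 7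
    2≤7 = s≤s (s≤s z≤n)
    3<7 : 3 < 7
    3<7 = s≤s (s≤s (s≤s (s≤s z≤n)))
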